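{- For every Boolean function $f$, $$L_+(f^{\uparrow})\le L_h(f)\le L_{0p}(f)\quad\text{and}\quad L_+(f^{\uparrow})\le L_0(f).$$ If $f$ is monotone, then $L_+(f)=L_h(f)=L_0(f)=L_{0p}(f)$.
   Context: A DeMorgan circuit on $x_1,\dots,x_n$ has fan-in-2 AND/OR gates and inputs $0,1,x_i,\bar x_i$; its size is the number of non-input gates; it is monotone if it has no negated inputs. Produced terms: at an input gate, the literal/constant itself; at an OR gate, the union of the sets at its inputs; at an AND gate, all $t_1\land t_2$ with $t_i$ produced at the two inputs (no simplification $x\bar x=0$). A zero-term contains some $x_i$ together with $\bar x_i$. A prime implicant of $f$ is a non-zero term $t$ with $t\le f$ such that no proper subterm satisfies this. Ternary logic on $\{0,\mathfrak u,1\}$ ($\mathfrak u=1/2$): AND $=\min$, OR $=\max$, NOT $=1-x$; $F$ has a hazard at $\alpha\in\{0,\mathfrak u,1\}^n$ if $F$ is constant on all Boolean vectors obtained from $\alpha$ by replacing each $\mathfrak u$ by $0$ or $1$, but $F(\alpha)=\mathfrak u$; hazard-free means no hazard anywhere. $L_h(f)$: minimum size of a hazard-free DeMorgan circuit computing $f$; $L_+(g)$: minimum size of a monotone circuit computing a monotone $g$; $L_0(f)$: minimum size of a DeMorgan circuit computing $f$ and producing no zero-terms; $L_{0p}(f)$: minimum size of a DeMorgan circuit computing $f$, producing no zero-terms, and producing all prime implicants of $f$. $f^{\uparrow}(x)=\bigvee_{z\le x}f(z)$. -}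

module Defs where

open import Data.Nat using (ℕ; zero; suc; _≤_)
open import Data.Fin using (Fin; zero; suc)
open import Data.Bool using (Bool; true; false; _∧_; _∨_; not)
  renaming (_≤_ to _≤ᵇ_)
open import Data.List using (List; []; _∷_; _++_)
open import Data.List.Membership.Propositional using (_∈_)
open import Data.Product using (Σ; ∃; ∃-syntax; _×_; _,_)
open import Data.Sum using (_⊎_)
open import Data.Unit using (⊤)
open import Relation.Nullary using (¬_)
open import Relation.Binary.PropositionalEquality using (_≡_)
open import Function.Bundles using (_⇔_)

BVec : ℕ → Set
BVec n = Fin n → Bool

BoolFun : ℕ → Set
BoolFun n = BVec n → Bool

_≤ᵛ_ : ∀ {n} → BVec n → BVec n → Set
x ≤ᵛ y = ∀ i → x i ≤ᵇ y i

MonotoneFun : ∀ {n} → BoolFun n → Set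
MonotoneFun f = ∀ x y → x ≤ᵛ y → f x ≤ᵇ f y

IsUpClosureOf : ∀ {n} → BoolFun n → BoolFun n → Set
IsUpClosureOf g f = ∀ x → (g x ≡ true) ⇔ (∃[ z ] (z ≤ᵛ x × f z ≡ true))

data Input (n : ℕ) : Set where
  c0 c1 : Input n
  pos neg : Fin n → Input n

data Op : Set where
  AND OR : Op

data Node (n k : ℕ) : Set where
  inp  : Input n → Node n k
  gate : Fin k → Node n k

-- Circ n k : a list of k gates; each new gate may use inputs and all
-- earlier gates.  In (C ▷ g), the new gate g is 'gate zero' and the
-- gates of C are 'gate (suc j)'.
data Circ (n : ℕ) : ℕ → Set where
  []  : Circ n zero
  _▷_ : ∀ {k} → Circ n k → Op × Node n k × Node n k → Circ n (suc k)

record Circuit (n : ℕ) : Set where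
  constructor circuit
  field
    size  : ℕ
    gates : Circ n size
    out   : Node n size
open Circuit public

NodeMono : ∀ {n k} → Node n k → Set
NodeMono {n} (inp a) = ∀ i → ¬ (a ≡ neg i)
NodeMono (gate _) = ⊤

CircMono : ∀ {n k} → Circ n k → Set
CircMono [] = ⊤
CircMono (C ▷ (_ , u , v)) = CircMono C × NodeMono u × NodeMono v

IsMonotoneCircuit : ∀ {n} → Circuit n → Set
IsMonotoneCircuit C = CircMono (gates C) × NodeMono (out C)

record Sig : Set₁ where
  field
    Car  : Set
    zer one : Car
    and or : Car → Car → Car
    neg′ : Car → Car

module _ (S : Sig) where
  open Sig S

  evalInp : ∀ {n} → (Fin n → Car) → Input n → Car
  evalInp x c0 = zer
  evalInp x c1 = one
  evalInp x (pos i) = x i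
  evalInp x (neg i) = neg′ (x i)

  evalOp : Op → Car → Car → Car
  evalOp AND = and
  evalOp OR  = or

  evalNode : ∀ {n k} → Circ n k → (Fin n → Car) → Node n k → Car
  evalNode C x (inp a) = evalInp x a
  evalNode (C ▷ (o , u , v)) x (gate zero) =
    evalOp o (evalNode C x u) (evalNode C x v)
  evalNode (C ▷ _) x (gate (suc j)) = evalNode C x (gate j)

  evalCircuit : ∀ {n} → Circuit n → (Fin n → Car) → Car
  evalCircuit C x = evalNode (gates C) x (out C)

BoolSig : Sig
BoolSig = record { Car = Bool ; zer = false ; one = true
                 ; and = _∧_ ; or = _∨_ ; neg′ = not }

⟦_⟧ : ∀ {n} → Circuit n → BoolFun n
⟦ C ⟧ = evalCircuit BoolSig C

Computes : ∀ {n} → Circuit n → BoolFun n → Set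
Computes C f = ∀ x → ⟦ C ⟧ x ≡ f x

-- Ternary logic {0, u, 1} with 0 < u < 1

data 𝕋 : Set where
  𝟘 𝔲 𝟙 : 𝕋

_⊓_ : 𝕋 → 𝕋 → 𝕋
𝟘 ⊓ _ = 𝟘
𝟙 ⊓ b = b
𝔲 ⊓ 𝟘 = 𝟘
𝔲 ⊓ 𝔲 = 𝔲
𝔲 ⊓ 𝟙 = 𝔲

_⊔_ : 𝕋 → 𝕋 → 𝕋
𝟙 ⊔ _ = 𝟙
𝟘 ⊔ b = b
𝔲 ⊔ 𝟙 = 𝟙
𝔲 ⊔ 𝔲 = 𝔲
𝔲 ⊔ 𝟘 = 𝔲

¬𝕋 : 𝕋 → 𝕋
¬𝕋 𝟘 = 𝟙
¬𝕋 𝔲 = 𝔲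
¬𝕋 𝟙 = 𝟘

TernSig : Sig
TernSig = record { Car = 𝕋 ; zer = 𝟘 ; one = 𝟙
                 ; and = _⊓_ ; or = _⊔_ ; neg′ = ¬𝕋 }

embed : Bool → 𝕋
embed false = 𝟘
embed true  = 𝟙

Resolves : ∀ {n} → BVec n → (Fin n → 𝕋) → Set
Resolves β α = ∀ i → α i ≡ 𝔲 ⊎ α i ≡ embed (β i)

HazardAt : ∀ {n} → Circuit n → (Fin n → 𝕋) → Set
HazardAt C α =
  (∃[ c ] (∀ β → Resolves β α → evalCircuit TernSig C (λ i → embed (β i)) ≡ embed c))
  × evalCircuit TernSig C α ≡ 𝔲

HazardFree : ∀ {n} → Circuit n → Set
HazardFree C = ∀ α → ¬ HazardAt C α

-- atoms of a term: literals (x_i if the Bool is true, ¬x_i if false)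
-- and the constant 0; the constant 1 is the empty term.
data Atom (n : ℕ) : Set where
  lit   : Fin n → Bool → Atom n
  zeroA : Atom n

Term : ℕ → Set
Term n = List (Atom n)

inputTerm : ∀ {n} → Input n → Term n
inputTerm c0 = zeroA ∷ []
inputTerm c1 = []
inputTerm (pos i) = lit i true ∷ []
inputTerm (neg i) = lit i false ∷ []

ProducedAt : ∀ {n k} → Circ n k → Node n k → Term n → Set
ProducedAt C (inp a) t = t ≡ inputTerm a
ProducedAt (C ▷ (OR , u , v)) (gate zero) t =
  ProducedAt C u t ⊎ ProducedAt C v t
ProducedAt (C ▷ (AND , u , v)) (gate zero) t =
  ∃[ t₁ ] ∃[ t₂ ] (ProducedAt C u t₁ × ProducedAt C v t₂ × t ≡ t₁ ++ t₂)
ProducedAt (C ▷ _) (gate (suc j)) t = ProducedAt C (gate j) t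

Produces : ∀ {n} → Circuit n → Term n → Set
Produces C t = ProducedAt (gates C) (out C) t

ZeroTerm : ∀ {n} → Term n → Set
ZeroTerm t = ∃[ i ] (lit i true ∈ t × lit i false ∈ t)

NoZeroTerms : ∀ {n} → Circuit n → Set
NoZeroTerms C = ∀ t → Produces C t → ¬ ZeroTerm t

atomVal : ∀ {n} → Atom n → BVec n → Bool
atomVal (lit i true)  x = x i
atomVal (lit i false) x = not (x i)
atomVal zeroA x = false

termVal : ∀ {n} → Term n → BVec n → Bool
termVal [] x = true
termVal (a ∷ t) x = atomVal a x ∧ termVal t x

_≤ᵗ_ : ∀ {n} → Term n → BoolFun n → Set
t ≤ᵗ f = ∀ x → termVal t x ≡ true → f x ≡ true

_⊆ᵗ_ : ∀ {n} → Term n → Term n → Set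
s ⊆ᵗ t = ∀ {a} → a ∈ s → a ∈ t

_⊂ᵗ_ : ∀ {n} → Term n → Term n → Set
s ⊂ᵗ t = s ⊆ᵗ t × ¬ (t ⊆ᵗ s)

_≈ᵗ_ : ∀ {n} → Term n → Term n → Set
s ≈ᵗ t = s ⊆ᵗ t × t ⊆ᵗ s

NonZeroTerm : ∀ {n} → Term n → Set
NonZeroTerm t = ¬ (zeroA ∈ t) × ¬ ZeroTerm t

PrimeImplicant : ∀ {n} → BoolFun n → Term n → Set
PrimeImplicant f t =
  NonZeroTerm t × t ≤ᵗ f × (∀ s → s ⊂ᵗ t → ¬ (s ≤ᵗ f))

ProducesAllPrimeImplicants : ∀ {n} → Circuit n → BoolFun n → Set
ProducesAllPrimeImplicants C f =
  ∀ p → PrimeImplicant f p → ∃[ t ] (Produces C t × t ≈ᵗ p)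

-- Complexity measures, as "m is the minimum size of a circuit in class P"

IsMinSize : ∀ {n} → (Circuit n → Set) → ℕ → Set
IsMinSize {n} P m =
  (∃[ C ] (P C × size C ≡ m)) × (∀ (C : Circuit n) → P C → m ≤ size C)

Lh : ∀ {n} → BoolFun n → ℕ → Set
Lh f = IsMinSize (λ C → Computes C f × HazardFree C)

L₊ : ∀ {n} → BoolFun n → ℕ → Set
L₊ g = IsMinSize (λ C → Computes C g × IsMonotoneCircuit C)

L₀ : ∀ {n} → BoolFun n → ℕ → Set
L₀ f = IsMinSize (λ C → Computes C f × NoZeroTerms C)

L₀ₚ : ∀ {n} → BoolFun n → ℕ → Set
L₀ₚ f = IsMinSize (λ C → Computes C f × NoZeroTerms C
                          × ProducesAllPrimeImplicants C f)

-- Replacing every ¬x_i of a DeMorgan circuit C by 1 gives a monotone circuit of the same size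
-- computing x ↦ [C(α_x) ≠ 0], where α_x has 𝔲 at the ones of x and 0 elsewhere: the map
-- [· ≠ 0] commutes with min and max, and ¬α_x(i) is never 0. The Boolean resolutions of α_x are
-- the z ≤ x, so by monotonicity of Kleene logic in the information order this is f↑(x)
-- provided C(α_x) ≠ 𝔲 whenever f vanishes below x. For hazard-free C this holds by the
-- definition of a hazard. Without zero-terms, a produced term of value 𝔲 at α_x resolves to a
-- z ≤ x satisfying it, so C(z) = f(z) = 1. A circuit without zero-terms that produces all prime
-- implicants is hazard-free: a 0-hazard is excluded in the same way, and at a 1-hazard the term
-- of the subcube is an implicant, hence contains a prime implicant whose produced copy already
-- evaluates to 1. Finally, monotone circuits produce only positive terms, hence no zero-terms,
-- and all prime implicants of the function they compute; for monotone f, f↑ = f closes the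
-- chain of inequalities.

module Submission where

open import Defs
open import Data.Nat using (ℕ; suc; _≤_; _<_; z≤n; s≤s)
open import Data.Nat.Induction using (<-wellFounded)
open import Data.Nat.Properties using (≤-refl; ≤-trans; ≤-antisym; m≤n⇒m≤1+n)
open import Data.Fin using (Fin)
import Data.Fin.Properties as Fin
open import Data.Bool using (Bool; true; false; _∧_; not; if_then_else_; b≤b; f≤t)
  renaming (_≤_ to _≤ᵇ_)
import Data.Bool.Properties as Bool
open import Data.List using ([]; _∷_; _++_; concatMap; allFin)
open import Data.List.Membership.Propositional using (_∈_; _∉_; lose; find)
open import Data.List.Membership.Propositional.Properties
  using (∈-++⁻; ∈-concatMap⁺; ∈-concatMap⁻; ∈-allFin)
import Data.List.Membership.DecPropositional as DecMembership
import Data.List.Relation.Binary.Subset.DecPropositional as DecSubset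
open import Data.List.Relation.Unary.Any using (here; there; satisfied)
open import Data.List.Relation.Unary.All using (all?) renaming (lookup to lookupAll)
open import Data.List.Relation.Unary.All.Properties using (¬All⇒Any¬)
open import Data.Product using (_×_; _,_; ∃-syntax)
open import Data.Sum using (_⊎_; inj₁; inj₂)
open import Data.Empty using (⊥)
open import Data.Unit using (tt)
open import Function using (id; _∘_)
open import Function.Bundles using (mk⇔; Equivalence)
open import Induction.WellFounded using (Acc; acc)
open import Relation.Binary.Definitions using (DecidableEquality)
open import Relation.Nullary using (¬_; Dec; yes; no; does; contradiction)
open import Relation.Nullary.Decidable using (dec-true; dec-false)
open import Relation.Binary.PropositionalEquality
  using (_≡_; _≢_; refl; sym; trans; cong; cong₂; subst; module ≡-Reasoning)

private variable
  n k : ℕ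

-- Kleene logic

infix 4 _⊑_

data _⊑_ : 𝕋 → 𝕋 → Set where
  𝔲⊑     : ∀ {a} → 𝔲 ⊑ a
  ⊑-refl : ∀ {a} → a ⊑ a

𝔲⊓-⊑ : ∀ a b → 𝔲 ⊓ b ⊑ a ⊓ b
𝔲⊓-⊑ 𝟘 𝟘 = ⊑-refl
𝔲⊓-⊑ 𝔲 𝟘 = ⊑-refl
𝔲⊓-⊑ 𝟙 𝟘 = ⊑-refl
𝔲⊓-⊑ a 𝔲 = 𝔲⊑
𝔲⊓-⊑ a 𝟙 = 𝔲⊑

⊓𝔲-⊑ : ∀ a b → a ⊓ 𝔲 ⊑ a ⊓ b
⊓𝔲-⊑ 𝟘 b = ⊑-refl
⊓𝔲-⊑ 𝔲 b = 𝔲⊑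
⊓𝔲-⊑ 𝟙 b = 𝔲⊑

𝔲⊔-⊑ : ∀ a b → 𝔲 ⊔ b ⊑ a ⊔ b
𝔲⊔-⊑ a 𝟘 = 𝔲⊑
𝔲⊔-⊑ a 𝔲 = 𝔲⊑
𝔲⊔-⊑ 𝟘 𝟙 = ⊑-refl
𝔲⊔-⊑ 𝔲 𝟙 = ⊑-refl
𝔲⊔-⊑ 𝟙 𝟙 = ⊑-refl

⊔𝔲-⊑ : ∀ a b → a ⊔ 𝔲 ⊑ a ⊔ b
⊔𝔲-⊑ 𝟘 b = 𝔲⊑
⊔𝔲-⊑ 𝔲 b = 𝔲⊑
⊔𝔲-⊑ 𝟙 b = ⊑-refl

⊓-mono-⊑ : ∀ {a a′ b b′} → a ⊑ a′ → b ⊑ b′ → a ⊓ b ⊑ a′ ⊓ b′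
⊓-mono-⊑                   𝔲⊑     𝔲⊑     = 𝔲⊑
⊓-mono-⊑ {a′ = a′} {b = b} 𝔲⊑     ⊑-refl = 𝔲⊓-⊑ a′ b
⊓-mono-⊑ {a = a} {b′ = b′} ⊑-refl 𝔲⊑     = ⊓𝔲-⊑ a b′
⊓-mono-⊑                   ⊑-refl ⊑-refl = ⊑-refl

⊔-mono-⊑ : ∀ {a a′ b b′} → a ⊑ a′ → b ⊑ b′ → a ⊔ b ⊑ a′ ⊔ b′
⊔-mono-⊑                   𝔲⊑     𝔲⊑     = 𝔲⊑
⊔-mono-⊑ {a′ = a′} {b = b} 𝔲⊑     ⊑-refl = 𝔲⊔-⊑ a′ b
⊔-mono-⊑ {a = a} {b′ = b′} ⊑-refl 𝔲⊑     = ⊔𝔲-⊑ a b′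
⊔-mono-⊑                   ⊑-refl ⊑-refl = ⊑-refl

¬𝕋-mono-⊑ : ∀ {a b} → a ⊑ b → ¬𝕋 a ⊑ ¬𝕋 b
¬𝕋-mono-⊑ 𝔲⊑     = 𝔲⊑
¬𝕋-mono-⊑ ⊑-refl = ⊑-refl

⊓-assoc : ∀ a b c → a ⊓ (b ⊓ c) ≡ (a ⊓ b) ⊓ c
⊓-assoc 𝟘 b c = refl
⊓-assoc 𝟙 b c = refl
⊓-assoc 𝔲 𝟘 c = refl
⊓-assoc 𝔲 𝟙 c = refl
⊓-assoc 𝔲 𝔲 𝟘 = refl
⊓-assoc 𝔲 𝔲 𝔲 = refl
⊓-assoc 𝔲 𝔲 𝟙 = refl

⊓-identityʳ : ∀ a → a ⊓ 𝟙 ≡ a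
⊓-identityʳ 𝟘 = refl
⊓-identityʳ 𝔲 = refl
⊓-identityʳ 𝟙 = refl

⊓-zeroʳ : ∀ a → a ⊓ 𝟘 ≡ 𝟘
⊓-zeroʳ 𝟘 = refl
⊓-zeroʳ 𝔲 = refl
⊓-zeroʳ 𝟙 = refl

⊔-zeroʳ : ∀ a → a ⊔ 𝟙 ≡ 𝟙
⊔-zeroʳ 𝟘 = refl
⊔-zeroʳ 𝔲 = refl
⊔-zeroʳ 𝟙 = refl

⊓≡𝟙⇒ : ∀ a b → a ⊓ b ≡ 𝟙 → a ≡ 𝟙 × b ≡ 𝟙
⊓≡𝟙⇒ 𝟙 𝟙 refl = refl , refl
⊓≡𝟙⇒ 𝟘 b ()
⊓≡𝟙⇒ 𝔲 𝟘 ()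
⊓≡𝟙⇒ 𝔲 𝔲 ()
⊓≡𝟙⇒ 𝔲 𝟙 ()
⊓≡𝟙⇒ 𝟙 𝟘 ()
⊓≡𝟙⇒ 𝟙 𝔲 ()

⊔-sel : ∀ a b → a ⊔ b ≡ a ⊎ a ⊔ b ≡ b
⊔-sel 𝟘 b = inj₂ refl
⊔-sel 𝟙 b = inj₁ refl
⊔-sel 𝔲 𝟘 = inj₁ refl
⊔-sel 𝔲 𝔲 = inj₁ refl
⊔-sel 𝔲 𝟙 = inj₂ refl

≡𝔲⇒≢𝟘 : ∀ {a} → a ≡ 𝔲 → a ≢ 𝟘
≡𝔲⇒≢𝟘 refl ()

embed-injective : ∀ {a b} → embed a ≡ embed b → a ≡ b
embed-injective {false} {false} _ = refl
embed-injective {true}  {true}  _ = refl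

embed-not : ∀ b → embed (not b) ≡ ¬𝕋 (embed b)
embed-not false = refl
embed-not true  = refl

embed-evalOp : ∀ o a b →
  embed (evalOp BoolSig o a b) ≡ evalOp TernSig o (embed a) (embed b)
embed-evalOp AND false b = refl
embed-evalOp AND true  b = refl
embed-evalOp OR  false b = refl
embed-evalOp OR  true  b = refl

evalOp-mono-⊑ : ∀ o {a a′ b b′} → a ⊑ a′ → b ⊑ b′ →
  evalOp TernSig o a b ⊑ evalOp TernSig o a′ b′
evalOp-mono-⊑ AND = ⊓-mono-⊑
evalOp-mono-⊑ OR  = ⊔-mono-⊑

_⊑ᵛ_ : (α α′ : Fin n → 𝕋) → Set
α ⊑ᵛ α′ = ∀ i → α i ⊑ α′ i

embedᵛ : BVec n → Fin n → 𝕋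
embedᵛ β i = embed (β i)

evalNode-embed : (C : Circ n k) (β : BVec n) (v : Node n k) →
  evalNode TernSig C (embedᵛ β) v ≡ embed (evalNode BoolSig C β v)
evalNode-embed C β (inp c0)      = refl
evalNode-embed C β (inp c1)      = refl
evalNode-embed C β (inp (pos i)) = refl
evalNode-embed C β (inp (neg i)) = sym (embed-not (β i))
evalNode-embed (C ▷ (o , u , w)) β (gate Fin.zero) =
  trans (cong₂ (evalOp TernSig o) (evalNode-embed C β u) (evalNode-embed C β w))
        (sym (embed-evalOp o _ _))
evalNode-embed (C ▷ _) β (gate (Fin.suc j)) = evalNode-embed C β (gate j)

evalCircuit-embed : (C : Circuit n) (β : BVec n) →
  evalCircuit TernSig C (embedᵛ β) ≡ embed (⟦ C ⟧ β)
evalCircuit-embed C β = evalNode-embed (gates C) β (out C)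

evalNode-mono-⊑ : (C : Circ n k) {α α′ : Fin n → 𝕋} → α ⊑ᵛ α′ → (v : Node n k) →
  evalNode TernSig C α v ⊑ evalNode TernSig C α′ v
evalNode-mono-⊑ C α⊑α′ (inp c0)      = ⊑-refl
evalNode-mono-⊑ C α⊑α′ (inp c1)      = ⊑-refl
evalNode-mono-⊑ C α⊑α′ (inp (pos i)) = α⊑α′ i
evalNode-mono-⊑ C α⊑α′ (inp (neg i)) = ¬𝕋-mono-⊑ (α⊑α′ i)
evalNode-mono-⊑ (C ▷ (o , u , w)) α⊑α′ (gate Fin.zero) =
  evalOp-mono-⊑ o (evalNode-mono-⊑ C α⊑α′ u) (evalNode-mono-⊑ C α⊑α′ w)
evalNode-mono-⊑ (C ▷ _) α⊑α′ (gate (Fin.suc j)) = evalNode-mono-⊑ C α⊑α′ (gate j)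

resolves⇒⊑ᵛ : ∀ {β : BVec n} {α} → Resolves β α → α ⊑ᵛ embedᵛ β
resolves⇒⊑ᵛ r i with r i
... | inj₁ α≡𝔲 rewrite α≡𝔲 = 𝔲⊑
... | inj₂ α≡β rewrite α≡β = ⊑-refl

evalCircuit-⊑-resolution : (C : Circuit n) {β : BVec n} {α : Fin n → 𝕋} →
  Resolves β α → evalCircuit TernSig C α ⊑ embed (⟦ C ⟧ β)
evalCircuit-⊑-resolution C {β} r =
  subst (_ ⊑_) (evalCircuit-embed C β) (evalNode-mono-⊑ (gates C) (resolves⇒⊑ᵛ r) (out C))

-- Produced terms

atomT : Atom n → (Fin n → 𝕋) → 𝕋
atomT (lit i true)  α = α i
atomT (lit i false) α = ¬𝕋 (α i)
atomT zeroA         α = 𝟘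

termT : Term n → (Fin n → 𝕋) → 𝕋
termT []      α = 𝟙
termT (a ∷ t) α = atomT a α ⊓ termT t α

termT-++ : (t₁ t₂ : Term n) (α : Fin n → 𝕋) →
  termT (t₁ ++ t₂) α ≡ termT t₁ α ⊓ termT t₂ α
termT-++ []       t₂ α = refl
termT-++ (a ∷ t₁) t₂ α =
  trans (cong (atomT a α ⊓_) (termT-++ t₁ t₂ α)) (⊓-assoc (atomT a α) _ _)

termT-inputTerm : (a : Input n) (α : Fin n → 𝕋) →
  termT (inputTerm a) α ≡ evalInp TernSig α a
termT-inputTerm c0      α = refl
termT-inputTerm c1      α = refl
termT-inputTerm (pos i) α = ⊓-identityʳ (α i)
termT-inputTerm (neg i) α = ⊓-identityʳ (¬𝕋 (α i))

atomT-embed : (a : Atom n) (β : BVec n) → atomT a (embedᵛ β) ≡ embed (atomVal a β)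
atomT-embed (lit i true)  β = refl
atomT-embed (lit i false) β = sym (embed-not (β i))
atomT-embed zeroA         β = refl

termT-embed : (t : Term n) (β : BVec n) → termT t (embedᵛ β) ≡ embed (termVal t β)
termT-embed []      β = refl
termT-embed (a ∷ t) β =
  trans (cong₂ _⊓_ (atomT-embed a β) (termT-embed t β))
        (sym (embed-evalOp AND (atomVal a β) (termVal t β)))

termT-𝟘 : ∀ {a} {t : Term n} (α : Fin n → 𝕋) → a ∈ t → atomT a α ≡ 𝟘 → termT t α ≡ 𝟘
termT-𝟘 α (here refl) a≡𝟘 = cong (_⊓ _) a≡𝟘
termT-𝟘 {t = b ∷ t} α (there a∈t) a≡𝟘 =
  trans (cong (atomT b α ⊓_) (termT-𝟘 α a∈t a≡𝟘)) (⊓-zeroʳ (atomT b α))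

termT-𝟙 : (t : Term n) (α : Fin n → 𝕋) → (∀ {a} → a ∈ t → atomT a α ≡ 𝟙) → termT t α ≡ 𝟙
termT-𝟙 []      α all𝟙 = refl
termT-𝟙 (a ∷ t) α all𝟙 = cong₂ _⊓_ (all𝟙 (here refl)) (termT-𝟙 t α (all𝟙 ∘ there))

termVal-true⁺ : (t : Term n) (β : BVec n) →
  (∀ {a} → a ∈ t → atomVal a β ≡ true) → termVal t β ≡ true
termVal-true⁺ []      β allTrue = refl
termVal-true⁺ (a ∷ t) β allTrue =
  cong₂ _∧_ (allTrue (here refl)) (termVal-true⁺ t β (allTrue ∘ there))

termVal-true⁻ : (t : Term n) (β : BVec n) →
  termVal t β ≡ true → ∀ {a} → a ∈ t → atomVal a β ≡ true
termVal-true⁻ (a ∷ t) β t≡true (here refl) = Bool.∧-conicalˡ _ _ t≡true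
termVal-true⁻ (a ∷ t) β t≡true (there a∈t) =
  termVal-true⁻ t β (Bool.∧-conicalʳ (atomVal a β) _ t≡true) a∈t

produced-𝟙 : (C : Circ n k) (v : Node n k) {t : Term n} (α : Fin n → 𝕋) →
  ProducedAt C v t → termT t α ≡ 𝟙 → evalNode TernSig C α v ≡ 𝟙
produced-𝟙 C (inp a) α refl t≡𝟙 = trans (sym (termT-inputTerm a α)) t≡𝟙
produced-𝟙 (C ▷ (OR , u , w)) (gate Fin.zero) α (inj₁ pu) t≡𝟙 =
  cong (_⊔ _) (produced-𝟙 C u α pu t≡𝟙)
produced-𝟙 (C ▷ (OR , u , w)) (gate Fin.zero) α (inj₂ pw) t≡𝟙 =
  trans (cong (_ ⊔_) (produced-𝟙 C w α pw t≡𝟙)) (⊔-zeroʳ _)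
produced-𝟙 (C ▷ (AND , u , w)) (gate Fin.zero) α (t₁ , t₂ , pu , pw , refl) t≡𝟙
  with ⊓≡𝟙⇒ (termT t₁ α) (termT t₂ α) (trans (sym (termT-++ t₁ t₂ α)) t≡𝟙)
... | t₁≡𝟙 , t₂≡𝟙 = cong₂ _⊓_ (produced-𝟙 C u α pu t₁≡𝟙) (produced-𝟙 C w α pw t₂≡𝟙)
produced-𝟙 (C ▷ (AND , _)) (gate (Fin.suc j)) α p t≡𝟙 = produced-𝟙 C (gate j) α p t≡𝟙
produced-𝟙 (C ▷ (OR  , _)) (gate (Fin.suc j)) α p t≡𝟙 = produced-𝟙 C (gate j) α p t≡𝟙

witness-term : (C : Circ n k) (v : Node n k) (α : Fin n → 𝕋) →
  ∃[ t ] (ProducedAt C v t × termT t α ≡ evalNode TernSig C α v)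
witness-term C (inp a) α = inputTerm a , refl , termT-inputTerm a α
witness-term (C ▷ (OR , u , w)) (gate Fin.zero) α
  with ⊔-sel (evalNode TernSig C α u) (evalNode TernSig C α w)
... | inj₁ ⊔≡u = let t , pu , t≡u = witness-term C u α in t , inj₁ pu , trans t≡u (sym ⊔≡u)
... | inj₂ ⊔≡w = let t , pw , t≡w = witness-term C w α in t , inj₂ pw , trans t≡w (sym ⊔≡w)
witness-term (C ▷ (AND , u , w)) (gate Fin.zero) α =
  let t₁ , pu , t₁≡u = witness-term C u α
      t₂ , pw , t₂≡w = witness-term C w α
  in t₁ ++ t₂ , (t₁ , t₂ , pu , pw , refl) , trans (termT-++ t₁ t₂ α) (cong₂ _⊓_ t₁≡u t₂≡w)
witness-term (C ▷ (AND , _)) (gate (Fin.suc j)) α = witness-term C (gate j) α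
witness-term (C ▷ (OR  , _)) (gate (Fin.suc j)) α = witness-term C (gate j) α

produced-true : (C : Circuit n) {t : Term n} (β : BVec n) →
  Produces C t → termVal t β ≡ true → ⟦ C ⟧ β ≡ true
produced-true C {t} β p t≡true = embed-injective (begin
  embed (⟦ C ⟧ β)                              ≡⟨ evalCircuit-embed C β ⟨
  evalCircuit TernSig C (embedᵛ β)             ≡⟨ produced-𝟙 (gates C) (out C) _ p t≡𝟙 ⟩
  𝟙                                            ∎)
  where
  open ≡-Reasoning
  t≡𝟙 : termT t (embedᵛ β) ≡ 𝟙
  t≡𝟙 = trans (termT-embed t β) (cong embed t≡true)

produced⇒implicant : (C : Circuit n) {f : BoolFun n} {t : Term n} → Computes C f →
  Produces C t → t ≤ᵗ f
produced⇒implicant C comp p x sat = trans (sym (comp x)) (produced-true C x p sat)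

witness-true : (C : Circuit n) (β : BVec n) → ⟦ C ⟧ β ≡ true →
  ∃[ t ] (Produces C t × termVal t β ≡ true)
witness-true C β C≡true =
  let t , p , t≡C = witness-term (gates C) (out C) (embedᵛ β)
  in t , p , embed-injective (begin
       embed (termVal t β)                 ≡⟨ termT-embed t β ⟨
       termT t (embedᵛ β)                  ≡⟨ t≡C ⟩
       evalCircuit TernSig C (embedᵛ β)    ≡⟨ evalCircuit-embed C β ⟩
       embed (⟦ C ⟧ β)                     ≡⟨ cong embed C≡true ⟩
       embed true                          ∎)
  where open ≡-Reasoning

_≟ᴬ_ : DecidableEquality (Atom n)
lit i b ≟ᴬ lit j c with i Fin.≟ j | b Bool.≟ c
... | yes refl | yes refl = yes refl
... | no i≢j   | _        = no λ { refl → i≢j refl }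
... | yes _    | no b≢c   = no λ { refl → b≢c refl }
lit i b ≟ᴬ zeroA   = no λ ()
zeroA   ≟ᴬ lit j c = no λ ()
zeroA   ≟ᴬ zeroA   = yes refl

_∈?_ : (a : Atom n) (t : Term n) → Dec (a ∈ t)
_∈?_ {n} = DecMembership._∈?_ (_≟ᴬ_ {n})

_⊆?_ : (s t : Term n) → Dec (s ⊆ᵗ t)
_⊆?_ {n} = DecSubset._⊆?_ (_≟ᴬ_ {n})

fill : Bool → 𝕋 → Bool
fill b 𝟘 = false
fill b 𝔲 = b
fill b 𝟙 = true

resolveAlong : Term n → (Fin n → 𝕋) → BVec n
resolveAlong t α i = fill (does (lit i true ∈? t)) (α i)

resolveAlong-resolves : (t : Term n) (α : Fin n → 𝕋) → Resolves (resolveAlong t α) α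
resolveAlong-resolves t α i with α i
... | 𝟘 = inj₂ refl
... | 𝔲 = inj₁ refl
... | 𝟙 = inj₂ refl

resolveAlong-satisfies : (t : Term n) (α : Fin n → 𝕋) → ¬ ZeroTerm t → termT t α ≢ 𝟘 →
  termVal t (resolveAlong t α) ≡ true
resolveAlong-satisfies t α noPair t≢𝟘 = termVal-true⁺ t _ atomTrue
  where
  atomTrue : ∀ {a} → a ∈ t → atomVal a (resolveAlong t α) ≡ true
  atomTrue {lit i true} x∈t with lit i true ∈? t | α i in αi
  ... | no x∉t | _ = contradiction x∈t x∉t
  ... | yes _  | 𝟘 = contradiction (termT-𝟘 α x∈t αi) t≢𝟘
  ... | yes _  | 𝔲 = refl
  ... | yes _  | 𝟙 = refl
  atomTrue {lit i false} x̄∈t with lit i true ∈? t | α i in αi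
  ... | yes x∈t | _ = contradiction (i , x∈t , x̄∈t) noPair
  ... | no _    | 𝟘 = refl
  ... | no _    | 𝔲 = refl
  ... | no _    | 𝟙 = contradiction (termT-𝟘 α x̄∈t (cong ¬𝕋 αi)) t≢𝟘
  atomTrue {zeroA} 0∈t = contradiction (termT-𝟘 α 0∈t refl) t≢𝟘

noZeroTerms⇒resolution : (C : Circuit n) → NoZeroTerms C → (α : Fin n → 𝕋) →
  evalCircuit TernSig C α ≢ 𝟘 → ∃[ β ] (Resolves β α × ⟦ C ⟧ β ≡ true)
noZeroTerms⇒resolution C noZero α C≢𝟘 =
  let t , p , t≡C = witness-term (gates C) (out C) α
      t≢𝟘 = λ t≡𝟘 → C≢𝟘 (trans (sym t≡C) t≡𝟘)
  in resolveAlong t α , resolveAlong-resolves t α ,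
     produced-true C _ p (resolveAlong-satisfies t α (noZero t p) t≢𝟘)

-- Prime implicants

nonZero-⊆ : {s t : Term n} → s ⊆ᵗ t → NonZeroTerm t → NonZeroTerm s
nonZero-⊆ s⊆t (no0 , noPair) =
  (no0 ∘ s⊆t) , λ (i , x∈s , x̄∈s) → noPair (i , s⊆t x∈s , s⊆t x̄∈s)

⊈⇒∃∉ : {s t : Term n} → ¬ (s ⊆ᵗ t) → ∃[ a ] (a ∈ s × a ∉ t)
⊈⇒∃∉ {s = s} {t} s⊈t with all? (_∈? t) s
... | yes all∈ = contradiction (λ {a} → lookupAll all∈) s⊈t
... | no ¬all∈ = find (¬All⇒Any¬ (_∈? t) s ¬all∈)

countIn : Term n → Term n → ℕ
countIn []      s = 0
countIn (a ∷ L) s = (if does (a ∈? s) then suc else id) (countIn L s)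

countIn-mono : (L : Term n) {s t : Term n} → s ⊆ᵗ t → countIn L s ≤ countIn L t
countIn-mono []      s⊆t = z≤n
countIn-mono (a ∷ L) {s} {t} s⊆t with a ∈? s | a ∈? t
... | yes _   | yes _   = s≤s (countIn-mono L s⊆t)
... | yes a∈s | no a∉t  = contradiction (s⊆t a∈s) a∉t
... | no _    | yes _   = m≤n⇒m≤1+n (countIn-mono L s⊆t)
... | no _    | no _    = countIn-mono L s⊆t

countIn-strict : (L : Term n) {s t : Term n} {a : Atom n} →
  s ⊆ᵗ t → a ∈ L → a ∈ t → a ∉ s → countIn L s < countIn L t
countIn-strict (b ∷ L) {s} {t} s⊆t (here refl) a∈t a∉s with b ∈? s | b ∈? t
... | yes a∈s | _       = contradiction a∈s a∉s
... | no _    | yes _   = s≤s (countIn-mono L s⊆t)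
... | no _    | no a∉t  = contradiction a∈t a∉t
countIn-strict (b ∷ L) {s} {t} s⊆t (there a∈L) a∈t a∉s with b ∈? s | b ∈? t
... | yes _   | yes _   = s≤s (countIn-strict L s⊆t a∈L a∈t a∉s)
... | yes b∈s | no b∉t  = contradiction (s⊆t b∈s) b∉t
... | no _    | yes _   = m≤n⇒m≤1+n (countIn-strict L s⊆t a∈L a∈t a∉s)
... | no _    | no _    = countIn-strict L s⊆t a∈L a∈t a∉s

implicant⇒prime-below : {f : BoolFun n} {T : Term n} → NonZeroTerm T → T ≤ᵗ f →
  ¬ ¬ (∃[ p ] (p ⊆ᵗ T × PrimeImplicant f p))
implicant⇒prime-below {n} {f} {T} nonZeroT T≤f noPrime =
  descend T (λ a∈T → a∈T) T≤f (<-wellFounded _)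
  where
  descend : (p : Term n) → p ⊆ᵗ T → p ≤ᵗ f → Acc _<_ (countIn T p) → ⊥
  descend p p⊆T p≤f (acc smaller) =
    noPrime (p , p⊆T , nonZero-⊆ p⊆T nonZeroT , p≤f , minimal)
    where
    minimal : ∀ s → s ⊂ᵗ p → ¬ (s ≤ᵗ f)
    minimal s (s⊆p , p⊈s) s≤f =
      let a , a∈p , a∉s = ⊈⇒∃∉ p⊈s
      in descend s (p⊆T ∘ s⊆p) s≤f (smaller (countIn-strict T s⊆p (p⊆T a∈p) a∈p a∉s))

literalOf : Fin n → 𝕋 → Term n
literalOf i 𝟘 = lit i false ∷ []
literalOf i 𝔲 = []
literalOf i 𝟙 = lit i true ∷ []

-- The term whose satisfying vectors are exactly the resolutions of α.
cubeTerm : (Fin n → 𝕋) → Term n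
cubeTerm {n} α = concatMap (λ i → literalOf i (α i)) (allFin n)

cubeTerm-𝟙 : (α : Fin n → 𝕋) {a : Atom n} → a ∈ cubeTerm α → atomT a α ≡ 𝟙
cubeTerm-𝟙 {n} α a∈T =
  let i , a∈lit = satisfied (∈-concatMap⁻ (λ i → literalOf i (α i)) {xs = allFin n} a∈T)
  in literal-𝟙 i a∈lit
  where
  literal-𝟙 : ∀ i {a} → a ∈ literalOf i (α i) → atomT a α ≡ 𝟙
  literal-𝟙 i a∈lit with α i in αi | a∈lit
  ... | 𝟘 | here refl rewrite αi = refl
  ... | 𝟙 | here refl rewrite αi = refl

cubeTerm-∋ : (α : Fin n → 𝕋) (i : Fin n) (b : Bool) → α i ≡ embed b → lit i b ∈ cubeTerm α
cubeTerm-∋ {n} α i b αi =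
  ∈-concatMap⁺ (λ j → literalOf j (α j)) {xs = allFin n} (lose (∈-allFin i) (literal-∋ b αi))
  where
  literal-∋ : ∀ b → α i ≡ embed b → lit i b ∈ literalOf i (α i)
  literal-∋ false αi rewrite αi = here refl
  literal-∋ true  αi rewrite αi = here refl

cubeTerm-resolves : (α : Fin n → 𝕋) (x : BVec n) →
  termVal (cubeTerm α) x ≡ true → Resolves x α
cubeTerm-resolves α x sat i with α i in αi | x i in xi
... | 𝔲 | _     = inj₁ refl
... | 𝟘 | false = inj₂ refl
... | 𝟙 | true  = inj₂ refl
... | 𝟘 | true  =
  contradiction (trans (cong not (sym xi)) (termVal-true⁻ _ x sat (cubeTerm-∋ α i false αi))) λ ()
... | 𝟙 | false =
  contradiction (trans (sym xi) (termVal-true⁻ _ x sat (cubeTerm-∋ α i true αi))) λ ()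

all𝟙⇒nonZero : (t : Term n) (α : Fin n → 𝕋) → (∀ {a} → a ∈ t → atomT a α ≡ 𝟙) → NonZeroTerm t
all𝟙⇒nonZero t α all𝟙 =
  (λ 0∈t → contradiction (all𝟙 0∈t) λ ()) ,
  λ (i , x∈t , x̄∈t) → contradiction (trans (cong ¬𝕋 (sym (all𝟙 x∈t))) (all𝟙 x̄∈t)) λ ()

noZeroTerms-primes⇒hazardFree : (C : Circuit n) {f : BoolFun n} → Computes C f →
  NoZeroTerms C → ProducesAllPrimeImplicants C f → HazardFree C
noZeroTerms-primes⇒hazardFree C comp noZero primes α ((false , const0) , C≡𝔲) =
  let β , r , Cβ = noZeroTerms⇒resolution C noZero α (≡𝔲⇒≢𝟘 C≡𝔲)
  in contradiction (trans (sym (const0 β r)) (trans (evalCircuit-embed C β) (cong embed Cβ))) λ ()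
noZeroTerms-primes⇒hazardFree C {f} comp noZero primes α ((true , const1) , C≡𝔲) =
  implicant⇒prime-below (all𝟙⇒nonZero _ α (cubeTerm-𝟙 α)) cube≤f λ (p , p⊆cube , prime) →
    let t , pt , t⊆p , _ = primes p prime
        C≡𝟙 = produced-𝟙 (gates C) (out C) α pt (termT-𝟙 t α (cubeTerm-𝟙 α ∘ p⊆cube ∘ t⊆p))
    in contradiction (trans (sym C≡𝟙) C≡𝔲) λ ()
  where
  cube≤f : cubeTerm α ≤ᵗ f
  cube≤f x sat = trans (sym (comp x)) (embed-injective
    (trans (sym (evalCircuit-embed C x)) (const1 x (cubeTerm-resolves α x sat))))

-- Monotonisation

dropNegation : Input n → Input n
dropNegation c0      = c0
dropNegation c1      = c1
dropNegation (pos i) = pos i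
dropNegation (neg i) = c1

monotoniseNode : Node n k → Node n k
monotoniseNode (inp a)  = inp (dropNegation a)
monotoniseNode (gate j) = gate j

monotoniseCirc : Circ n k → Circ n k
monotoniseCirc []                = []
monotoniseCirc (C ▷ (o , u , w)) = monotoniseCirc C ▷ (o , monotoniseNode u , monotoniseNode w)

monotonise : Circuit n → Circuit n
monotonise C = circuit (size C) (monotoniseCirc (gates C)) (monotoniseNode (out C))

monotoniseNode-mono : (v : Node n k) → NodeMono (monotoniseNode v)
monotoniseNode-mono (inp c0)      i ()
monotoniseNode-mono (inp c1)      i ()
monotoniseNode-mono (inp (pos j)) i ()
monotoniseNode-mono (inp (neg j)) i ()
monotoniseNode-mono (gate j)      = tt

monotoniseCirc-mono : (C : Circ n k) → CircMono (monotoniseCirc C)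
monotoniseCirc-mono []                = tt
monotoniseCirc-mono (C ▷ (o , u , w)) =
  monotoniseCirc-mono C , monotoniseNode-mono u , monotoniseNode-mono w

monotonise-monotone : (C : Circuit n) → IsMonotoneCircuit (monotonise C)
monotonise-monotone C = monotoniseCirc-mono (gates C) , monotoniseNode-mono (out C)

-- The subcube {z ∣ z ≤ x}, as a ternary vector.
below : BVec n → Fin n → 𝕋
below x i = if x i then 𝔲 else 𝟘

nonzero : 𝕋 → Bool
nonzero 𝟘 = false
nonzero 𝔲 = true
nonzero 𝟙 = true

nonzero-evalOp : ∀ o a b →
  nonzero (evalOp TernSig o a b) ≡ evalOp BoolSig o (nonzero a) (nonzero b)
nonzero-evalOp AND 𝟘 b = refl
nonzero-evalOp AND 𝟙 b = refl
nonzero-evalOp AND 𝔲 𝟘 = refl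
nonzero-evalOp AND 𝔲 𝔲 = refl
nonzero-evalOp AND 𝔲 𝟙 = refl
nonzero-evalOp OR  𝟘 b = refl
nonzero-evalOp OR  𝟙 b = refl
nonzero-evalOp OR  𝔲 𝟘 = refl
nonzero-evalOp OR  𝔲 𝔲 = refl
nonzero-evalOp OR  𝔲 𝟙 = refl

evalNode-monotonise : (C : Circ n k) (x : BVec n) (v : Node n k) →
  evalNode BoolSig (monotoniseCirc C) x (monotoniseNode v)
    ≡ nonzero (evalNode TernSig C (below x) v)
evalNode-monotonise C x (inp c0) = refl
evalNode-monotonise C x (inp c1) = refl
evalNode-monotonise C x (inp (pos i)) with x i
... | false = refl
... | true  = refl
evalNode-monotonise C x (inp (neg i)) with x i
... | false = refl
... | true  = refl
evalNode-monotonise (C ▷ (o , u , w)) x (gate Fin.zero) =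
  trans (cong₂ (evalOp BoolSig o) (evalNode-monotonise C x u) (evalNode-monotonise C x w))
        (sym (nonzero-evalOp o _ _))
evalNode-monotonise (C ▷ _) x (gate (Fin.suc j)) = evalNode-monotonise C x (gate j)

≤ᵛ-refl : {x : BVec n} → x ≤ᵛ x
≤ᵛ-refl _ = Bool.≤-refl

resolves-below⇒≤ᵛ : {x z : BVec n} → Resolves z (below x) → z ≤ᵛ x
resolves-below⇒≤ᵛ {x = x} {z} r i with x i | z i | r i
... | true  | false | _       = f≤t
... | true  | true  | _       = b≤b
... | false | false | _       = b≤b
... | false | true  | inj₂ ()

≤ᵛ⇒resolves-below : {x z : BVec n} → z ≤ᵛ x → Resolves z (below x)
≤ᵛ⇒resolves-below {x = x} {z} z≤x i with x i | z i | z≤x i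
... | true  | _     | _   = inj₁ refl
... | false | false | _   = inj₂ refl

StableOnZeroCubes : Circuit n → BoolFun n → Set
StableOnZeroCubes C f =
  ∀ x → (∀ z → z ≤ᵛ x → f z ≡ false) → evalCircuit TernSig C (below x) ≢ 𝔲

upClosure-false : {f g : BoolFun n} → IsUpClosureOf g f →
  ∀ {x} → g x ≡ false → ∀ z → z ≤ᵛ x → f z ≡ false
upClosure-false up {x} gx≡false z z≤x = Bool.¬-not λ fz≡true →
  contradiction (trans (sym gx≡false) (Equivalence.from (up x) (z , z≤x , fz≡true))) λ ()

⊑𝟙⇒nonzero : ∀ {a} → a ⊑ 𝟙 → nonzero a ≡ true
⊑𝟙⇒nonzero 𝔲⊑     = refl
⊑𝟙⇒nonzero ⊑-refl = refl

⊑𝟘⇒nonzero : ∀ {a} → a ⊑ 𝟘 → a ≢ 𝔲 → nonzero a ≡ false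
⊑𝟘⇒nonzero 𝔲⊑     a≢𝔲 = contradiction refl a≢𝔲
⊑𝟘⇒nonzero ⊑-refl _   = refl

evalCircuit-below-⊑ : (C : Circuit n) {f : BoolFun n} → Computes C f →
  ∀ {x z b} → z ≤ᵛ x → f z ≡ b → evalCircuit TernSig C (below x) ⊑ embed b
evalCircuit-below-⊑ C comp {z = z} z≤x fz≡b =
  subst (λ b → _ ⊑ embed b) (trans (comp z) fz≡b)
        (evalCircuit-⊑-resolution C (≤ᵛ⇒resolves-below z≤x))

monotonise-computes-up : (C : Circuit n) {f g : BoolFun n} → Computes C f →
  IsUpClosureOf g f → StableOnZeroCubes C f → Computes (monotonise C) g
monotonise-computes-up C {g = g} comp up stable x
  rewrite evalNode-monotonise (gates C) x (out C) with g x in gx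
... | true  = let z , z≤x , fz = Equivalence.to (up x) gx
              in ⊑𝟙⇒nonzero (evalCircuit-below-⊑ C comp z≤x fz)
... | false = let vanish = upClosure-false up gx
              in ⊑𝟘⇒nonzero (evalCircuit-below-⊑ C comp ≤ᵛ-refl (vanish x ≤ᵛ-refl))
                            (stable x vanish)

hazardFree⇒stable : (C : Circuit n) {f : BoolFun n} → Computes C f → HazardFree C →
  StableOnZeroCubes C f
hazardFree⇒stable C comp hazardFree x vanish C≡𝔲 =
  hazardFree (below x) ((false , constant) , C≡𝔲)
  where
  constant : ∀ β → Resolves β (below x) → evalCircuit TernSig C (embedᵛ β) ≡ embed false
  constant β r = trans (evalCircuit-embed C β)
                       (cong embed (trans (comp β) (vanish β (resolves-below⇒≤ᵛ r))))

noZeroTerms⇒stable : (C : Circuit n) {f : BoolFun n} → Computes C f → NoZeroTerms C →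
  StableOnZeroCubes C f
noZeroTerms⇒stable C comp noZero x vanish C≡𝔲 =
  let β , r , Cβ = noZeroTerms⇒resolution C noZero (below x) (≡𝔲⇒≢𝟘 C≡𝔲)
  in contradiction (trans (sym Cβ) (trans (comp β) (vanish β (resolves-below⇒≤ᵛ r)))) λ ()

-- Monotone circuits

monotone⇒positive : (C : Circ n k) (v : Node n k) {t : Term n} → CircMono C → NodeMono v →
  ProducedAt C v t → ∀ {i} → lit i false ∉ t
monotone⇒positive C (inp c0)      _ _  refl (here ())
monotone⇒positive C (inp (pos j)) _ _  refl (here ())
monotone⇒positive C (inp (neg j)) _ mv refl _ = mv j refl
monotone⇒positive (C ▷ (OR , u , w)) (gate Fin.zero) (mC , mu , mw) _ (inj₁ pu) =
  monotone⇒positive C u mC mu pu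
monotone⇒positive (C ▷ (OR , u , w)) (gate Fin.zero) (mC , mu , mw) _ (inj₂ pw) =
  monotone⇒positive C w mC mw pw
monotone⇒positive (C ▷ (AND , u , w)) (gate Fin.zero) (mC , mu , mw) _
                  (t₁ , t₂ , pu , pw , refl) x̄∈t with ∈-++⁻ t₁ x̄∈t
... | inj₁ x̄∈t₁ = monotone⇒positive C u mC mu pu x̄∈t₁
... | inj₂ x̄∈t₂ = monotone⇒positive C w mC mw pw x̄∈t₂
monotone⇒positive (C ▷ (AND , _)) (gate (Fin.suc j)) (mC , _) _ p =
  monotone⇒positive C (gate j) mC tt p
monotone⇒positive (C ▷ (OR  , _)) (gate (Fin.suc j)) (mC , _) _ p =
  monotone⇒positive C (gate j) mC tt p

monotone⇒noZeroTerms : (M : Circuit n) → IsMonotoneCircuit M → NoZeroTerms M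
monotone⇒noZeroTerms M (mC , mout) t p (i , _ , x̄∈t) =
  monotone⇒positive (gates M) (out M) mC mout p x̄∈t

positives : Term n → BVec n
positives p i = does (lit i true ∈? p)

positives-satisfies : (p : Term n) → NonZeroTerm p → termVal p (positives p) ≡ true
positives-satisfies p (no0 , noPair) = termVal-true⁺ p _ atomTrue
  where
  atomTrue : ∀ {a} → a ∈ p → atomVal a (positives p) ≡ true
  atomTrue {lit i true}  x∈p = dec-true (lit i true ∈? p) x∈p
  atomTrue {lit i false} x̄∈p =
    cong not (dec-false (lit i true ∈? p) λ x∈p → noPair (i , x∈p , x̄∈p))
  atomTrue {zeroA}       0∈p = contradiction 0∈p no0

positive-satisfied⇒⊆ : (t p : Term n) → (∀ {i} → lit i false ∉ t) →
  termVal t (positives p) ≡ true → t ⊆ᵗ p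
positive-satisfied⇒⊆ t p positive sat {lit i true} x∈t
  with lit i true ∈? p | termVal-true⁻ t _ sat x∈t
... | yes x∈p | _ = x∈p
positive-satisfied⇒⊆ t p positive sat {lit i false} x̄∈t = contradiction x̄∈t positive
positive-satisfied⇒⊆ t p positive sat {zeroA} 0∈t =
  contradiction (termVal-true⁻ t _ sat 0∈t) λ ()

prime⇒⊆ : {f : BoolFun n} {p t : Term n} → PrimeImplicant f p → t ⊆ᵗ p → t ≤ᵗ f → p ⊆ᵗ t
prime⇒⊆ {p = p} {t} (_ , _ , minimal) t⊆p t≤f with p ⊆? t
... | yes p⊆t = p⊆t
... | no p⊈t  = contradiction t≤f (minimal t (t⊆p , p⊈t))

-- Evaluating at the positive literals of a prime p yields a produced term inside p.
monotone⇒allPrimes : (M : Circuit n) {f : BoolFun n} → IsMonotoneCircuit M → Computes M f →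
  ProducesAllPrimeImplicants M f
monotone⇒allPrimes M (mC , mout) comp p prime@(nonZero , p≤f , _) =
  let t , pt , sat = witness-true M (positives p)
                       (trans (comp _) (p≤f _ (positives-satisfies p nonZero)))
      t⊆p = positive-satisfied⇒⊆ t p (monotone⇒positive (gates M) (out M) mC mout pt) sat
  in t , pt , t⊆p , prime⇒⊆ prime t⊆p (produced⇒implicant M comp pt)

monotone⇒upClosure : {f : BoolFun n} → MonotoneFun f → IsUpClosureOf f f
monotone⇒upClosure {f = f} mono x = mk⇔ (λ fx → x , ≤ᵛ-refl , fx) λ (z , z≤x , fz) →
  true≤⇒≡true (subst (_≤ᵇ f x) fz (mono z x z≤x))
  where
  true≤⇒≡true : ∀ {b} → true ≤ᵇ b → b ≡ true
  true≤⇒≡true b≤b = refl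

-- Minimum sizes

minSize-≤ : {P Q : Circuit n → Set} {m k : ℕ} →
  (∀ C → P C → ∃[ D ] (Q D × size D ≤ size C)) → IsMinSize Q m → IsMinSize P k → m ≤ k
minSize-≤ simulate (_ , minimalQ) ((C , pC , refl) , _) =
  let D , qD , D≤C = simulate C pC in ≤-trans (minimalQ D qD) D≤C

minSize-antitone : {P Q : Circuit n → Set} {m k : ℕ} →
  (∀ C → P C → Q C) → IsMinSize Q m → IsMinSize P k → m ≤ k
minSize-antitone P⇒Q = minSize-≤ λ C pC → C , P⇒Q C pC , ≤-refl

L₊-up-≤ : {f g : BoolFun n} {P : Circuit n → Set} {a b : ℕ} →
  (∀ C → Computes C f → P C → StableOnZeroCubes C f) → IsUpClosureOf g f →
  L₊ g a → IsMinSize (λ C → Computes C f × P C) b → a ≤ b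
L₊-up-≤ stable up = minSize-≤ λ C (comp , pC) →
  monotonise C ,
  (monotonise-computes-up C comp up (stable C comp pC) , monotonise-monotone C) ,
  ≤-refl

L₊-up≤Lh : {f g : BoolFun n} {a b : ℕ} → IsUpClosureOf g f → L₊ g a → Lh f b → a ≤ b
L₊-up≤Lh = L₊-up-≤ λ C → hazardFree⇒stable C

L₊-up≤L₀ : {f g : BoolFun n} {a d : ℕ} → IsUpClosureOf g f → L₊ g a → L₀ f d → a ≤ d
L₊-up≤L₀ = L₊-up-≤ λ C → noZeroTerms⇒stable C

Lh≤L₀ₚ : {f : BoolFun n} {b c : ℕ} → Lh f b → L₀ₚ f c → b ≤ c
Lh≤L₀ₚ = minSize-antitone λ C (comp , noZero , primes) →
  comp , noZeroTerms-primes⇒hazardFree C comp noZero primes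

L₀≤L₀ₚ : {f : BoolFun n} {d c : ℕ} → L₀ f d → L₀ₚ f c → d ≤ c
L₀≤L₀ₚ = minSize-antitone λ C (comp , noZero , _) → comp , noZero

L₀ₚ≤L₊ : {f : BoolFun n} {c a : ℕ} → L₀ₚ f c → L₊ f a → c ≤ a
L₀ₚ≤L₊ = minSize-antitone λ M (comp , mono) →
  comp , monotone⇒noZeroTerms M mono , monotone⇒allPrimes M mono comp

corollary2 : ∀ {n} (f f↑ : BoolFun n) → IsUpClosureOf f↑ f →
    (∀ a b → L₊ f↑ a → Lh f b → a ≤ b)
    × (∀ b c → Lh f b → L₀ₚ f c → b ≤ c)
    × (∀ a d → L₊ f↑ a → L₀ f d → a ≤ d)
    × (MonotoneFun f → ∀ a b d c → L₊ f a → Lh f b → L₀ f d → L₀ₚ f c →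
         a ≡ b × b ≡ d × d ≡ c)
corollary2 f f↑ up =
  (λ _ _ → L₊-up≤Lh up) , (λ _ _ → Lh≤L₀ₚ) , (λ _ _ → L₊-up≤L₀ up) , monotoneCase
  where
  monotoneCase : MonotoneFun f → ∀ a b d c → L₊ f a → Lh f b → L₀ f d → L₀ₚ f c →
                 a ≡ b × b ≡ d × d ≡ c
  monotoneCase mono a b d c La Lb Ld Lc =
    ≤-antisym a≤b (≤-trans b≤c c≤a) ,
    ≤-antisym (≤-trans b≤c (≤-trans c≤a a≤d)) (≤-trans d≤c (≤-trans c≤a a≤b)) ,
    ≤-antisym d≤c (≤-trans c≤a a≤d)
    where
    a≤b : a ≤ b
    a≤b = L₊-up≤Lh (monotone⇒upClosure mono) La Lb
    a≤d : a ≤ d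
    a≤d = L₊-up≤L₀ (monotone⇒upClosure mono) La Ld
    b≤c : b ≤ c
    b≤c = Lh≤L₀ₚ Lb Lc
    c≤a : c ≤ a
    c≤a = L₀ₚ≤L₊ Lc La
    d≤c : d ≤ c
    d≤c = L₀≤L₀ₚ Ld Lc
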